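{- Let $F$ be a finite field of prime order at least $5$, let $G$ be a finite-dimensional vector space over $F$, let $M_1,\dots,M_d:G\to\widehat G$ be self-adjoint linear transformations, and let $r\geq0$. Then there exist a linear subspace $H$ of $G$ of codimension at most $rd$, an integer $0\leq d'\leq d$, and self-adjoint linear transformations $M_1',\dots,M_{d'}':H\to\widehat H$ such that \[\mathrm{rank}(a_1M_1'+\dots+a_{d'}M_{d'}')>r\] whenever $(a_1,\dots,a_{d'})\in F^{d'}\setminus\{0\}$; in particular $M_1',\dots,M_{d'}'$ are linearly independent. Moreover, for each $i$, the restriction $M_i|_H$, regarded as a map $H\to\widehat H$ (via $x\mapsto (y\mapsto M_ix\cdot y)$ for $x,y\in H$), lies in the $F$-span of $M_1',\dots,M_{d'}'$.
   Context: $\widehat G$ is the group of homomorphisms $G\to\mathbb{R}/\mathbb{Z}$, written $x\mapsto\xi\cdot x$ (an $F$-vector space). A linear map $M:G\to\widehat G$ is self-adjoint if $Mx\cdot y=My\cdot x$; its rank is the codimension of its kernel. -}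

module Defs where

open import Data.Nat using (ℕ; zero; suc; NonZero; _<_; _∸_)
import Data.Nat as ℕ
open import Data.Nat.DivMod using (_mod_)
open import Data.Fin using (Fin; toℕ; zero; suc)
open import Data.Product using (Σ; ∃; _×_)
open import Relation.Binary.PropositionalEquality using (_≡_)

module _ (p : ℕ) .{{_ : NonZero p}} where

  𝔽 : Set
  𝔽 = Fin p

  0F : 𝔽
  0F = 0 mod p

  _+F_ : 𝔽 → 𝔽 → 𝔽
  x +F y = (toℕ x ℕ.+ toℕ y) mod p

  _*F_ : 𝔽 → 𝔽 → 𝔽
  x *F y = (toℕ x ℕ.* toℕ y) mod p

  infixl 6 _+F_
  infixl 7 _*F_

  ∑ : ∀ {k} → (Fin k → 𝔽) → 𝔽
  ∑ {zero} f = 0F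
  ∑ {suc k} f = f zero +F ∑ (λ i → f (suc i))

  Vec : ℕ → Set
  Vec n = Fin n → 𝔽

  -- A linear map M : G → Ĝ, given by its matrix: (M x)·y = Σ_a Σ_b x_a M_ab y_b.
  -- (Ĝ = Hom(G, ℝ/ℤ) = Hom(G, (1/p)ℤ/ℤ) ≅ Hom(G, F) ≅ F^n.)
  Form : ℕ → Set
  Form n = Fin n → Fin n → 𝔽

  pair : ∀ {n} → Form n → Vec n → Vec n → 𝔽
  pair M x y = ∑ (λ a → ∑ (λ b → x a *F (M a b *F y b)))

  SelfAdjoint : ∀ {n} → Form n → Set
  SelfAdjoint M = ∀ x y → pair M x y ≡ pair M y x

  InKer : ∀ {n} → Form n → Vec n → Set
  InKer M x = ∀ y → pair M x y ≡ 0F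

  lincomb : ∀ {n k} → (Fin k → 𝔽) → (Fin k → Vec n) → Vec n
  lincomb c v i = ∑ (λ j → c j *F v j i)

  LinIndep : ∀ {n k} → (Fin k → Vec n) → Set
  LinIndep {k = k} v = (c : Fin k → 𝔽) → (∀ i → lincomb c v i ≡ 0F) → ∀ j → c j ≡ 0F

  KerDim : ∀ {n} → Form n → ℕ → Set
  KerDim {n} M k = Σ (Fin k → Vec n) (λ v →
      (∀ j → InKer M (v j)) × LinIndep v ×
      (∀ x → InKer M x → ∃ (λ (c : Fin k → 𝔽) → ∀ i → x i ≡ lincomb c v i)))

  -- rank M = codim ker M = n - dim ker M;  RankGT M r  means  rank M > r
  RankGT : ∀ {n} → Form n → ℕ → Set
  RankGT {n} M r = ∀ k → KerDim M k → r < n ∸ k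

  combF : ∀ {n d} → (Fin d → 𝔽) → (Fin d → Form n) → Form n
  combF a Ms x y = ∑ (λ j → a j *F Ms j x y)

  -- the restriction of M to H = span(e), as a map H → Ĥ, written in the basis e
  restrict : ∀ {n m} → Form n → (Fin m → Vec n) → Form m
  restrict M e a b = pair M (e a) (e b)

module Submission where

-- Call a nonzero combination ∑ aⱼ Mⱼ degenerate if it vanishes identically on some
-- subspace V of codimension at most r; a combination of rank at most r is degenerate, with V its kernel.
-- If there is none, the Mᵢ themselves qualify (H = G). Otherwise pick j with aⱼ ≠ 0: on V the form Mⱼ
-- is a combination of the other d - 1 forms, so restricting those to V and recursing costs codimension
-- at most r per step. Whether a degenerate combination exists is decided by exhaustive search, since
-- F and all spaces involved are finite.

open import Defs
open import Data.Nat as ℕ using (ℕ; NonZero; zero; suc; _%_)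
import Data.Nat.Properties as ℕ
open import Data.Nat.DivMod using (_mod_; m<n⇒m%n≡m; %-distribˡ-+; %-distribˡ-*; n%n≡0; m*n%n≡0)
open import Data.Nat.Primality using (Prime)
open import Data.Nat.Coprimality using (prime⇒coprime; coprime-Bézout)
open import Data.Nat.GCD using (module Bézout)
open import Data.Fin as Fin using (Fin; toℕ)
import Data.Fin.Properties as Fin
open import Data.Product using (Σ; ∃; _×_; _,_; proj₁; proj₂)
open import Data.Sum using (inj₁; inj₂)
open import Data.Empty using (⊥-elim)
open import Data.Vec.Functional using ([]; _∷_; head; tail)
open import Data.Vec.Functional.Relation.Binary.Pointwise using (Pointwise)
open import Level using (0ℓ)
open import Relation.Binary using (Rel; Reflexive; Symmetric; _Respects_)
open import Relation.Nullary using (Dec; yes; no; ¬_; ¬?)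
open import Relation.Nullary.Decidable using (map′; decidable-stable; _×-dec_; _→-dec_)
open import Relation.Unary as U using (Pred)
open import Relation.Binary.PropositionalEquality
open import Algebra.Bundles using (CommutativeRing)
open import Algebra.Structures using (IsCommutativeRing)
open import Algebra.Consequences.Propositional using (comm∧idˡ⇒id; comm∧invʳ⇒inv; comm∧distrˡ⇒distrʳ)

module PrimeField (p : ℕ) .{{_ : NonZero p}} where

  private
    _+_ _*_ : 𝔽 p → 𝔽 p → 𝔽 p
    _+_ = _+F_ p
    _*_ = _*F_ p
    infixl 6 _+_
    infixl 7 _*_

  ι : ℕ → 𝔽 p
  ι n = n mod p

  1F : 𝔽 p
  1F = ι 1

  infix 8 -F_
  -F_ : 𝔽 p → 𝔽 p
  -F x = ι (p ℕ.∸ toℕ x)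

  toℕ-ι : ∀ n → toℕ (ι n) ≡ n % p
  toℕ-ι n = Fin.toℕ-fromℕ< _

  toℕ-0F : toℕ (0F p) ≡ 0
  toℕ-0F = trans (toℕ-ι 0) (m*n%n≡0 0 p)

  ι-toℕ : ∀ x → ι (toℕ x) ≡ x
  ι-toℕ x = Fin.toℕ-injective (trans (toℕ-ι (toℕ x)) (m<n⇒m%n≡m (Fin.toℕ<n x)))

  ι-+ : ∀ m n → ι m + ι n ≡ ι (m ℕ.+ n)
  ι-+ m n = Fin.toℕ-injective (begin
    toℕ (ι m + ι n)                 ≡⟨ toℕ-ι _ ⟩
    (toℕ (ι m) ℕ.+ toℕ (ι n)) % p   ≡⟨ cong₂ (λ u v → (u ℕ.+ v) % p) (toℕ-ι m) (toℕ-ι n) ⟩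
    (m % p ℕ.+ n % p) % p           ≡⟨ %-distribˡ-+ m n p ⟨
    (m ℕ.+ n) % p                   ≡⟨ toℕ-ι (m ℕ.+ n) ⟨
    toℕ (ι (m ℕ.+ n))               ∎)
    where open ≡-Reasoning

  ι-* : ∀ m n → ι m * ι n ≡ ι (m ℕ.* n)
  ι-* m n = Fin.toℕ-injective (begin
    toℕ (ι m * ι n)                 ≡⟨ toℕ-ι _ ⟩
    (toℕ (ι m) ℕ.* toℕ (ι n)) % p   ≡⟨ cong₂ (λ u v → (u ℕ.* v) % p) (toℕ-ι m) (toℕ-ι n) ⟩
    (m % p ℕ.* (n % p)) % p         ≡⟨ %-distribˡ-* m n p ⟨
    (m ℕ.* n) % p                   ≡⟨ toℕ-ι (m ℕ.* n) ⟨
    toℕ (ι (m ℕ.* n))               ∎)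
    where open ≡-Reasoning

  ι-p : ι p ≡ 0F p
  ι-p = Fin.toℕ-injective (trans (toℕ-ι p) (trans (n%n≡0 p) (sym toℕ-0F)))

  ι-elim₁ : (P : 𝔽 p → Set) → (∀ a → P (ι a)) → ∀ x → P x
  ι-elim₁ P h x = subst P (ι-toℕ x) (h (toℕ x))

  ι-elim₂ : (P : 𝔽 p → 𝔽 p → Set) → (∀ a b → P (ι a) (ι b)) → ∀ x y → P x y
  ι-elim₂ P h = ι-elim₁ (λ x → ∀ y → P x y) (λ a → ι-elim₁ (P (ι a)) (h a))

  ι-elim₃ : (P : 𝔽 p → 𝔽 p → 𝔽 p → Set) → (∀ a b c → P (ι a) (ι b) (ι c)) → ∀ x y z → P x y z
  ι-elim₃ P h = ι-elim₁ (λ x → ∀ y z → P x y z) (λ a → ι-elim₂ (P (ι a)) (h a))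

  -- The ring laws are inherited from ℕ along the surjective homomorphism ι.
  private module Laws where
    open ≡-Reasoning

    +-assoc : ∀ x y z → x + y + z ≡ x + (y + z)
    +-assoc = ι-elim₃ _ λ a b c → begin
      ι a + ι b + ι c       ≡⟨ cong (_+ ι c) (ι-+ a b) ⟩
      ι (a ℕ.+ b) + ι c     ≡⟨ ι-+ _ c ⟩
      ι (a ℕ.+ b ℕ.+ c)     ≡⟨ cong ι (ℕ.+-assoc a b c) ⟩
      ι (a ℕ.+ (b ℕ.+ c))   ≡⟨ ι-+ a _ ⟨
      ι a + ι (b ℕ.+ c)     ≡⟨ cong (ι a +_) (ι-+ b c) ⟨
      ι a + (ι b + ι c)     ∎

    *-assoc : ∀ x y z → x * y * z ≡ x * (y * z)
    *-assoc = ι-elim₃ _ λ a b c → begin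
      ι a * ι b * ι c       ≡⟨ cong (_* ι c) (ι-* a b) ⟩
      ι (a ℕ.* b) * ι c     ≡⟨ ι-* _ c ⟩
      ι (a ℕ.* b ℕ.* c)     ≡⟨ cong ι (ℕ.*-assoc a b c) ⟩
      ι (a ℕ.* (b ℕ.* c))   ≡⟨ ι-* a _ ⟨
      ι a * ι (b ℕ.* c)     ≡⟨ cong (ι a *_) (ι-* b c) ⟨
      ι a * (ι b * ι c)     ∎

    +-comm : ∀ x y → x + y ≡ y + x
    +-comm = ι-elim₂ _ λ a b → trans (ι-+ a b) (trans (cong ι (ℕ.+-comm a b)) (sym (ι-+ b a)))

    *-comm : ∀ x y → x * y ≡ y * x
    *-comm = ι-elim₂ _ λ a b → trans (ι-* a b) (trans (cong ι (ℕ.*-comm a b)) (sym (ι-* b a)))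

    +-identityˡ : ∀ x → 0F p + x ≡ x
    +-identityˡ = ι-elim₁ _ (ι-+ 0)

    *-identityˡ : ∀ x → 1F * x ≡ x
    *-identityˡ = ι-elim₁ _ λ a → trans (ι-* 1 a) (cong ι (ℕ.*-identityˡ a))

    *-distribˡ-+ : ∀ x y z → x * (y + z) ≡ x * y + x * z
    *-distribˡ-+ = ι-elim₃ _ λ a b c → begin
      ι a * (ι b + ι c)           ≡⟨ cong (ι a *_) (ι-+ b c) ⟩
      ι a * ι (b ℕ.+ c)           ≡⟨ ι-* a _ ⟩
      ι (a ℕ.* (b ℕ.+ c))         ≡⟨ cong ι (ℕ.*-distribˡ-+ a b c) ⟩
      ι (a ℕ.* b ℕ.+ a ℕ.* c)     ≡⟨ ι-+ _ _ ⟨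
      ι (a ℕ.* b) + ι (a ℕ.* c)   ≡⟨ cong₂ _+_ (ι-* a b) (ι-* a c) ⟨
      ι a * ι b + ι a * ι c       ∎

    -F‿inverseʳ : ∀ x → x + -F x ≡ 0F p
    -F‿inverseʳ x = begin
      x + -F x                        ≡⟨ cong (_+ -F x) (ι-toℕ x) ⟨
      ι (toℕ x) + ι (p ℕ.∸ toℕ x)     ≡⟨ ι-+ _ _ ⟩
      ι (toℕ x ℕ.+ (p ℕ.∸ toℕ x))     ≡⟨ cong ι (ℕ.m+[n∸m]≡n (ℕ.<⇒≤ (Fin.toℕ<n x))) ⟩
      ι p                             ≡⟨ ι-p ⟩
      0F p                            ∎

  isCommutativeRing : IsCommutativeRing _≡_ _+_ _*_ -F_ (0F p) 1F
  isCommutativeRing = record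
    { isRing = record
      { +-isAbelianGroup = record
        { isGroup = record
          { isMonoid = record
            { isSemigroup = record
              { isMagma = record { isEquivalence = isEquivalence ; ∙-cong = cong₂ _+_ }
              ; assoc = Laws.+-assoc }
            ; identity = comm∧idˡ⇒id Laws.+-comm Laws.+-identityˡ }
          ; inverse = comm∧invʳ⇒inv Laws.+-comm Laws.-F‿inverseʳ
          ; ⁻¹-cong = cong -F_ }
        ; comm = Laws.+-comm }
      ; *-cong = cong₂ _*_
      ; *-assoc = Laws.*-assoc
      ; *-identity = comm∧idˡ⇒id Laws.*-comm Laws.*-identityˡ
      ; distrib = Laws.*-distribˡ-+ , comm∧distrˡ⇒distrʳ Laws.*-comm Laws.*-distribˡ-+ }
    ; *-comm = Laws.*-comm }

  commutativeRing : CommutativeRing _ _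
  commutativeRing = record { isCommutativeRing = isCommutativeRing }

  open CommutativeRing commutativeRing using (*-comm; zeroʳ; +-identityʳ; ring; +-group)
  open import Algebra.Properties.Ring ring using (-‿distribʳ-*)
  open import Algebra.Properties.Group +-group using (inverseˡ-unique)

  *F-inverse : Prime p → ∀ x → x ≢ 0F p → ∃ λ y → x * y ≡ 1F
  *F-inverse p-prime x x≢0 = fromBézout (coprime-Bézout (prime⇒coprime p-prime {{toℕx≢0}} (Fin.toℕ<n x)))
    where
    open ≡-Reasoning

    toℕx≢0 : NonZero (toℕ x)
    toℕx≢0 = ℕ.≢-nonZero λ toℕx≡0 → x≢0 (Fin.toℕ-injective (trans toℕx≡0 (sym toℕ-0F)))

    ι[a*p]≡0 : ∀ a → ι (a ℕ.* p) ≡ 0F p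
    ι[a*p]≡0 a = trans (sym (ι-* a p)) (trans (cong (ι a *_) ι-p) (zeroʳ (ι a)))

    fromBézout : Bézout.Identity 1 p (toℕ x) → ∃ λ y → x * y ≡ 1F
    fromBézout (Bézout.+- a b 1+b*x≡a*p) = -F ι b , (begin
      x * (-F ι b)    ≡⟨ -‿distribʳ-* x (ι b) ⟨
      -F (x * ι b)    ≡⟨ cong -F_ (*-comm x (ι b)) ⟩
      -F (ι b * x)    ≡⟨ inverseˡ-unique 1F (ι b * x) 1+bx≡0 ⟨
      1F              ∎)
      where
      1+bx≡0 : 1F + ι b * x ≡ 0F p
      1+bx≡0 = begin
        1F + ι b * x              ≡⟨ cong (λ y → 1F + ι b * y) (ι-toℕ x) ⟨
        ι 1 + ι b * ι (toℕ x)     ≡⟨ cong (1F +_) (ι-* b _) ⟩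
        ι 1 + ι (b ℕ.* toℕ x)     ≡⟨ ι-+ 1 _ ⟩
        ι (1 ℕ.+ b ℕ.* toℕ x)     ≡⟨ cong ι 1+b*x≡a*p ⟩
        ι (a ℕ.* p)               ≡⟨ ι[a*p]≡0 a ⟩
        0F p                      ∎
    fromBézout (Bézout.-+ a b 1+a*p≡b*x) = ι b , (begin
      x * ι b                   ≡⟨ *-comm x (ι b) ⟩
      ι b * x                   ≡⟨ cong (ι b *_) (ι-toℕ x) ⟨
      ι b * ι (toℕ x)           ≡⟨ ι-* b _ ⟩
      ι (b ℕ.* toℕ x)           ≡⟨ cong ι 1+a*p≡b*x ⟨
      ι (1 ℕ.+ a ℕ.* p)         ≡⟨ ι-+ 1 _ ⟨
      1F + ι (a ℕ.* p)          ≡⟨ cong (1F +_) (ι[a*p]≡0 a) ⟩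
      1F + 0F p                 ≡⟨ +-identityʳ 1F ⟩
      1F                        ∎)

module Search where

  -- Predicates must respect _≈_ because functions are only determined up to pointwise equality.
  Searchable : (A : Set) → Rel A 0ℓ → Set₁
  Searchable A _≈_ = ∀ {P : Pred A 0ℓ} → P Respects _≈_ → U.Decidable P → Dec (∃ P)

  Fin-searchable : ∀ n → Searchable (Fin n) _≡_
  Fin-searchable n _ P? = Fin.any? P?

  Π-searchable : ∀ {A _≈_} → Reflexive _≈_ → Searchable A _≈_ → ∀ m → Searchable (Fin m → A) (Pointwise _≈_)
  Π-searchable ≈-refl search zero {P} resp P? = map′ ([] ,_) (λ (f , Pf) → resp (λ ()) Pf) (P? [])
  Π-searchable {A} {_≈_} ≈-refl search (suc m) {P} resp P? =
    map′ (λ (a , g , Pag) → a ∷ g , Pag) (λ (f , Pf) → head f , tail f , resp η Pf)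
      (search resp-head (λ a → Π-searchable ≈-refl search m (resp-tail a) (λ g → P? (a ∷ g))))
    where
    η : ∀ {f} → Pointwise _≈_ f (head f ∷ tail f)
    η Fin.zero    = ≈-refl
    η (Fin.suc i) = ≈-refl

    resp-head : (λ a → ∃ λ g → P (a ∷ g)) Respects _≈_
    resp-head a≈b (g , Pag) = g , resp (λ { Fin.zero → a≈b ; (Fin.suc i) → ≈-refl }) Pag

    resp-tail : ∀ a → (λ g → P (a ∷ g)) Respects Pointwise _≈_
    resp-tail a g≈h = resp (λ { Fin.zero → ≈-refl ; (Fin.suc i) → g≈h i })

  all? : ∀ {A _≈_} → Symmetric _≈_ → Searchable A _≈_ →
    ∀ {P : Pred A 0ℓ} → P Respects _≈_ → U.Decidable P → Dec (∀ x → P x)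
  all? ≈-sym search resp P? =
    map′ (λ ¬∃¬P x → decidable-stable (P? x) (λ ¬Px → ¬∃¬P (x , ¬Px))) (λ ∀P (x , ¬Px) → ¬Px (∀P x))
      (¬? (search (λ x≈y ¬Px Py → ¬Px (resp (≈-sym x≈y) Py)) (λ x → ¬? (P? x))))

module Forms (p : ℕ) .{{_ : NonZero p}} where

  open Search

  open PrimeField p using (commutativeRing)
  open CommutativeRing commutativeRing
    using ( _+_; _*_; -_; 0#; 1#; *-comm; *-assoc; *-identityˡ; zeroˡ; +-identityˡ; +-identityʳ
          ; ring; semiring; +-group; *-commutativeSemigroup)
  open import Algebra.Properties.Semiring.Sum semiring
    using (sum; sum-cong-≗; sum-remove; sum-replicate-zero; *-distribˡ-sum; *-distribʳ-sum)
    renaming (∑-comm to sum-comm)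
  open import Algebra.Properties.CommutativeSemigroup *-commutativeSemigroup using (x∙yz≈y∙xz)
  open import Algebra.Properties.Ring ring using (-‿distribˡ-*; -‿distribʳ-*)
  open import Algebra.Properties.Group +-group using (inverseˡ-unique)
  open ≡-Reasoning

  ∑≡sum : ∀ {k} (f : Fin k → 𝔽 p) → ∑ p f ≡ sum f
  ∑≡sum {zero} f = refl
  ∑≡sum {suc k} f = cong (f Fin.zero +_) (∑≡sum (λ i → f (Fin.suc i)))

  ∑-cong : ∀ {k} {f g : Fin k → 𝔽 p} → (∀ i → f i ≡ g i) → ∑ p f ≡ ∑ p g
  ∑-cong {f = f} {g} f≗g = trans (∑≡sum f) (trans (sum-cong-≗ f≗g) (sym (∑≡sum g)))

  ∑-comm : ∀ {m k} (f : Fin m → Fin k → 𝔽 p) → ∑ p (λ i → ∑ p (f i)) ≡ ∑ p (λ j → ∑ p (λ i → f i j))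
  ∑-comm f = begin
    ∑ p (λ i → ∑ p (f i))            ≡⟨ ∑-cong (λ i → ∑≡sum (f i)) ⟩
    ∑ p (λ i → sum (f i))            ≡⟨ ∑≡sum (λ i → sum (f i)) ⟩
    sum (λ i → sum (f i))            ≡⟨ sum-comm f ⟩
    sum (λ j → sum (λ i → f i j))    ≡⟨ ∑≡sum (λ j → sum (λ i → f i j)) ⟨
    ∑ p (λ j → sum (λ i → f i j))    ≡⟨ ∑-cong (λ j → ∑≡sum (λ i → f i j)) ⟨
    ∑ p (λ j → ∑ p (λ i → f i j))    ∎

  *-distribˡ-∑ : ∀ {k} x (f : Fin k → 𝔽 p) → x * ∑ p f ≡ ∑ p (λ i → x * f i)
  *-distribˡ-∑ x f = trans (cong (x *_) (∑≡sum f)) (trans (*-distribˡ-sum x f) (sym (∑≡sum (λ i → x * f i))))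

  *-distribʳ-∑ : ∀ {k} x (f : Fin k → 𝔽 p) → ∑ p f * x ≡ ∑ p (λ i → f i * x)
  *-distribʳ-∑ x f = trans (cong (_* x) (∑≡sum f)) (trans (*-distribʳ-sum x f) (sym (∑≡sum (λ i → f i * x))))

  ∑-remove : ∀ {k} (i : Fin (suc k)) (f : Fin (suc k) → 𝔽 p) → ∑ p f ≡ f i + ∑ p (λ j → f (Fin.punchIn i j))
  ∑-remove i f = trans (∑≡sum f) (trans (sum-remove {i = i} f) (cong (f i +_) (sym (∑≡sum (λ j → f (Fin.punchIn i j))))))

  ∑-zero : ∀ k → ∑ p {k} (λ _ → 0#) ≡ 0#
  ∑-zero k = trans (∑≡sum {k} (λ _ → 0#)) (sum-replicate-zero k)

  ∑-solve : ∀ {d} (a r : Fin (suc d) → 𝔽 p) (j : Fin (suc d)) b → b * a j ≡ 1# →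
    ∑ p (λ i → a i * r i) ≡ 0# → r j ≡ ∑ p (λ i → (- b * a (Fin.punchIn j i)) * r (Fin.punchIn j i))
  ∑-solve a r j b ba≡1 ∑ar≡0 = begin
    r j                      ≡⟨ *-identityˡ (r j) ⟨
    1# * r j                 ≡⟨ cong (_* r j) ba≡1 ⟨
    b * a j * r j            ≡⟨ *-assoc b (a j) (r j) ⟩
    b * (a j * r j)          ≡⟨ cong (b *_) (inverseˡ-unique _ _ (trans (sym (∑-remove j (λ i → a i * r i))) ∑ar≡0)) ⟩
    b * - rest               ≡⟨ -‿distribʳ-* b rest ⟨
    - (b * rest)             ≡⟨ -‿distribˡ-* b rest ⟩
    - b * rest               ≡⟨ *-distribˡ-∑ (- b) (λ i → a (Fin.punchIn j i) * r (Fin.punchIn j i)) ⟩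
    ∑ p (λ i → - b * (a (Fin.punchIn j i) * r (Fin.punchIn j i)))
                             ≡⟨ ∑-cong (λ i → *-assoc (- b) (a (Fin.punchIn j i)) (r (Fin.punchIn j i))) ⟨
    ∑ p (λ i → (- b * a (Fin.punchIn j i)) * r (Fin.punchIn j i)) ∎
    where
    rest : 𝔽 p
    rest = ∑ p (λ i → a (Fin.punchIn j i) * r (Fin.punchIn j i))

  δ : ∀ {k} → Fin k → Fin k → 𝔽 p
  δ Fin.zero    Fin.zero    = 1#
  δ Fin.zero    (Fin.suc _) = 0#
  δ (Fin.suc _) Fin.zero    = 0#
  δ (Fin.suc i) (Fin.suc j) = δ i j

  δ-sym : ∀ {k} (i j : Fin k) → δ i j ≡ δ j i
  δ-sym Fin.zero    Fin.zero    = refl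
  δ-sym Fin.zero    (Fin.suc j) = refl
  δ-sym (Fin.suc i) Fin.zero    = refl
  δ-sym (Fin.suc i) (Fin.suc j) = δ-sym i j

  ∑-δˡ : ∀ {k} (i : Fin k) (f : Fin k → 𝔽 p) → ∑ p (λ j → δ i j * f j) ≡ f i
  ∑-δˡ {suc k} Fin.zero f =
    trans (cong₂ _+_ (*-identityˡ _) (trans (∑-cong (λ j → zeroˡ (f (Fin.suc j)))) (∑-zero k))) (+-identityʳ _)
  ∑-δˡ {suc k} (Fin.suc i) f =
    trans (cong₂ _+_ (zeroˡ _) (∑-δˡ i (λ j → f (Fin.suc j)))) (+-identityˡ _)

  ∑-δʳ : ∀ {k} (i : Fin k) (f : Fin k → 𝔽 p) → ∑ p (λ j → f j * δ j i) ≡ f i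
  ∑-δʳ i f = trans (∑-cong (λ j → trans (*-comm (f j) _) (cong (_* f j) (δ-sym j i)))) (∑-δˡ i f)

  ∑²-linear : ∀ {m k l} (c : Fin l → 𝔽 p) (g : Fin l → Fin m → Fin k → 𝔽 p) (t : Fin m → Fin k → 𝔽 p) →
    (∀ a b → t a b ≡ ∑ p (λ j → c j * g j a b)) →
    ∑ p (λ a → ∑ p (t a)) ≡ ∑ p (λ j → c j * ∑ p (λ a → ∑ p (g j a)))
  ∑²-linear c g t t≡∑cg = begin
    ∑ p (λ a → ∑ p (t a))                               ≡⟨ ∑-cong (λ a → ∑-cong (t≡∑cg a)) ⟩
    ∑ p (λ a → ∑ p (λ b → ∑ p (λ j → c j * g j a b)))   ≡⟨ ∑-cong (λ a → ∑-comm (λ b j → c j * g j a b)) ⟩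
    ∑ p (λ a → ∑ p (λ j → ∑ p (λ b → c j * g j a b)))   ≡⟨ ∑-comm (λ a j → ∑ p (λ b → c j * g j a b)) ⟩
    ∑ p (λ j → ∑ p (λ a → ∑ p (λ b → c j * g j a b)))   ≡⟨ ∑-cong (λ j → ∑-cong (λ a → *-distribˡ-∑ (c j) (g j a))) ⟨
    ∑ p (λ j → ∑ p (λ a → c j * ∑ p (g j a)))           ≡⟨ ∑-cong (λ j → *-distribˡ-∑ (c j) (λ a → ∑ p (g j a))) ⟨
    ∑ p (λ j → c j * ∑ p (λ a → ∑ p (g j a)))           ∎

  pair-combF : ∀ {n d} (c : Fin d → 𝔽 p) (Ms : Fin d → Form p n) x y →
    pair p (combF p c Ms) x y ≡ ∑ p (λ j → c j * pair p (Ms j) x y)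
  pair-combF c Ms x y = ∑²-linear c (λ j a b → x a * (Ms j a b * y b)) _ λ a b → begin
    x a * (∑ p (λ j → c j * Ms j a b) * y b)       ≡⟨ cong (x a *_) (*-distribʳ-∑ (y b) (λ j → c j * Ms j a b)) ⟩
    x a * ∑ p (λ j → c j * Ms j a b * y b)         ≡⟨ *-distribˡ-∑ (x a) (λ j → c j * Ms j a b * y b) ⟩
    ∑ p (λ j → x a * (c j * Ms j a b * y b))       ≡⟨ ∑-cong (λ j → cong (x a *_) (*-assoc (c j) _ _)) ⟩
    ∑ p (λ j → x a * (c j * (Ms j a b * y b)))     ≡⟨ ∑-cong (λ j → x∙yz≈y∙xz (x a) (c j) _) ⟩
    ∑ p (λ j → c j * (x a * (Ms j a b * y b)))     ∎

  pair-lincombˡ : ∀ {n k} (M : Form p n) (c : Fin k → 𝔽 p) (v : Fin k → Vec p n) y →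
    pair p M (lincomb p c v) y ≡ ∑ p (λ j → c j * pair p M (v j) y)
  pair-lincombˡ M c v y = ∑²-linear c (λ j a b → v j a * (M a b * y b)) _ λ a b → begin
    ∑ p (λ j → c j * v j a) * (M a b * y b)        ≡⟨ *-distribʳ-∑ (M a b * y b) (λ j → c j * v j a) ⟩
    ∑ p (λ j → c j * v j a * (M a b * y b))        ≡⟨ ∑-cong (λ j → *-assoc (c j) _ _) ⟩
    ∑ p (λ j → c j * (v j a * (M a b * y b)))      ∎

  pair-lincombʳ : ∀ {n k} (M : Form p n) (c : Fin k → 𝔽 p) (v : Fin k → Vec p n) x →
    pair p M x (lincomb p c v) ≡ ∑ p (λ j → c j * pair p M x (v j))
  pair-lincombʳ M c v x = ∑²-linear c (λ j a b → x a * (M a b * v j b)) _ λ a b → begin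
    x a * (M a b * ∑ p (λ j → c j * v j b))        ≡⟨ cong (x a *_) (*-distribˡ-∑ (M a b) (λ j → c j * v j b)) ⟩
    x a * ∑ p (λ j → M a b * (c j * v j b))        ≡⟨ *-distribˡ-∑ (x a) (λ j → M a b * (c j * v j b)) ⟩
    ∑ p (λ j → x a * (M a b * (c j * v j b)))      ≡⟨ ∑-cong (λ j → cong (x a *_) (x∙yz≈y∙xz (M a b) (c j) _)) ⟩
    ∑ p (λ j → x a * (c j * (M a b * v j b)))      ≡⟨ ∑-cong (λ j → x∙yz≈y∙xz (x a) (c j) _) ⟩
    ∑ p (λ j → c j * (x a * (M a b * v j b)))      ∎

  pair-cong : ∀ {n} {M N : Form p n} {x x′ y y′ : Vec p n} → (∀ a b → M a b ≡ N a b) →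
    (∀ a → x a ≡ x′ a) → (∀ b → y b ≡ y′ b) → pair p M x y ≡ pair p N x′ y′
  pair-cong M≗N x≗x′ y≗y′ = ∑-cong (λ a → ∑-cong (λ b →
    cong₂ _*_ (x≗x′ a) (cong₂ _*_ (M≗N a b) (y≗y′ b))))

  combF-cong : ∀ {n d} {a a′ : Fin d → 𝔽 p} (Ms : Fin d → Form p n) → (∀ j → a j ≡ a′ j) →
    ∀ x y → combF p a Ms x y ≡ combF p a′ Ms x y
  combF-cong Ms a≗a′ x y = ∑-cong (λ j → cong (_* Ms j x y) (a≗a′ j))

  restrict-pair : ∀ {n k} (M : Form p n) (v : Fin k → Vec p n) x y →
    pair p (restrict p M v) x y ≡ pair p M (lincomb p x v) (lincomb p y v)
  restrict-pair M v x y = begin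
    ∑ p (λ a → ∑ p (λ b → x a * (m a b * y b)))  ≡⟨ ∑-cong (λ a → ∑-cong (λ b → cong (x a *_) (*-comm (m a b) (y b)))) ⟩
    ∑ p (λ a → ∑ p (λ b → x a * (y b * m a b)))  ≡⟨ ∑-cong (λ a → *-distribˡ-∑ (x a) (λ b → y b * m a b)) ⟨
    ∑ p (λ a → x a * ∑ p (λ b → y b * m a b))    ≡⟨ ∑-cong (λ a → cong (x a *_) (pair-lincombʳ M y v (v a))) ⟨
    ∑ p (λ a → x a * pair p M (v a) (lincomb p y v)) ≡⟨ pair-lincombˡ M x v (lincomb p y v) ⟨
    pair p M (lincomb p x v) (lincomb p y v)     ∎
    where m = restrict p M v

  restrict-selfAdjoint : ∀ {n k} (M : Form p n) (v : Fin k → Vec p n) → SelfAdjoint p M → SelfAdjoint p (restrict p M v)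
  restrict-selfAdjoint M v M-sa x y = begin
    pair p (restrict p M v) x y                  ≡⟨ restrict-pair M v x y ⟩
    pair p M (lincomb p x v) (lincomb p y v)     ≡⟨ M-sa (lincomb p x v) (lincomb p y v) ⟩
    pair p M (lincomb p y v) (lincomb p x v)     ≡⟨ restrict-pair M v y x ⟨
    pair p (restrict p M v) y x                  ∎

  restrict-δ : ∀ {n} (M : Form p n) a b → restrict p M δ a b ≡ M a b
  restrict-δ M a b = begin
    ∑ p (λ x → ∑ p (λ y → δ a x * (M x y * δ b y)))   ≡⟨ ∑-cong (λ x → *-distribˡ-∑ (δ a x) (λ y → M x y * δ b y)) ⟨
    ∑ p (λ x → δ a x * ∑ p (λ y → M x y * δ b y))     ≡⟨ ∑-cong (λ x → cong (δ a x *_) (∑-cong (λ y → cong (M x y *_) (δ-sym b y)))) ⟩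
    ∑ p (λ x → δ a x * ∑ p (λ y → M x y * δ y b))     ≡⟨ ∑-cong (λ x → cong (δ a x *_) (∑-δʳ b (M x))) ⟩
    ∑ p (λ x → δ a x * M x b)                         ≡⟨ ∑-δˡ a (λ x → M x b) ⟩
    M a b                                             ∎

  infix 4 _∈span_
  _∈span_ : ∀ {n d} → Form p n → (Fin d → Form p n) → Set
  N ∈span Ms = ∃ λ c → ∀ x y → N x y ≡ combF p c Ms x y

  ∈span-member : ∀ {n d} (Ms : Fin d → Form p n) j → Ms j ∈span Ms
  ∈span-member Ms j = δ j , λ x y → sym (∑-δˡ j (λ l → Ms l x y))

  ∈span-resp : ∀ {n d} {N N′ : Form p n} {Ms : Fin d → Form p n} →
    (∀ x y → N x y ≡ N′ x y) → N′ ∈span Ms → N ∈span Ms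
  ∈span-resp N≗N′ (c , N′≡) = c , λ x y → trans (N≗N′ x y) (N′≡ x y)

  ∈span-trans : ∀ {n d e} {N : Form p n} {Ms : Fin d → Form p n} {Ls : Fin e → Form p n} →
    N ∈span Ms → (∀ j → Ms j ∈span Ls) → N ∈span Ls
  ∈span-trans {Ms = Ms} {Ls} (β , N≡) Ms∈ = (λ l → ∑ p (λ j → β j * C j l)) , λ x y → begin
    _                                                    ≡⟨ N≡ x y ⟩
    ∑ p (λ j → β j * Ms j x y)                           ≡⟨ ∑-cong (λ j → cong (β j *_) (proj₂ (Ms∈ j) x y)) ⟩
    ∑ p (λ j → β j * ∑ p (λ l → C j l * Ls l x y))       ≡⟨ ∑-cong (λ j → *-distribˡ-∑ (β j) (λ l → C j l * Ls l x y)) ⟩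
    ∑ p (λ j → ∑ p (λ l → β j * (C j l * Ls l x y)))     ≡⟨ ∑-comm (λ j l → β j * (C j l * Ls l x y)) ⟩
    ∑ p (λ l → ∑ p (λ j → β j * (C j l * Ls l x y)))     ≡⟨ ∑-cong (λ l → ∑-cong (λ j → *-assoc (β j) (C j l) (Ls l x y))) ⟨
    ∑ p (λ l → ∑ p (λ j → β j * C j l * Ls l x y))       ≡⟨ ∑-cong (λ l → *-distribʳ-∑ (Ls l x y) (λ j → β j * C j l)) ⟨
    ∑ p (λ l → ∑ p (λ j → β j * C j l) * Ls l x y)       ∎
    where C = λ j → proj₁ (Ms∈ j)

  ∈span-restrict : ∀ {n k d} {N : Form p n} {Ms : Fin d → Form p n} (v : Fin k → Vec p n) →
    N ∈span Ms → restrict p N v ∈span (λ j → restrict p (Ms j) v)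
  ∈span-restrict {Ms = Ms} v (c , N≡) = c , λ x y →
    trans (pair-cong {x = v x} {y = v y} N≡ (λ _ → refl) (λ _ → refl)) (pair-combF c Ms (v x) (v y))

  TotallyIsotropic : ∀ {n k} → Form p n → (Fin k → Vec p n) → Set
  TotallyIsotropic C v = ∀ i j → pair p C (v i) (v j) ≡ 0#

  isotropic-combF⇒∈span : ∀ {n k d} (Ms : Fin (suc d) → Form p n) (a : Fin (suc d) → 𝔽 p) (v : Fin k → Vec p n)
    (j : Fin (suc d)) b → b * a j ≡ 1# → TotallyIsotropic (combF p a Ms) v →
    restrict p (Ms j) v ∈span (λ i → restrict p (Ms (Fin.punchIn j i)) v)
  isotropic-combF⇒∈span Ms a v j b ba≡1 iso = (λ i → - b * a (Fin.punchIn j i)) , λ x y →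
    ∑-solve a (λ i → restrict p (Ms i) v x y) j b ba≡1 (trans (sym (pair-combF a Ms (v x) (v y))) (iso x y))

  δ-linIndep : ∀ {n} → LinIndep p (δ {n})
  δ-linIndep c cδ≡0 j = trans (sym (∑-δʳ j c)) (cδ≡0 j)

  lincomb-linIndep : ∀ {n k m} {v : Fin k → Vec p n} {e : Fin m → Vec p k} →
    LinIndep p v → LinIndep p e → LinIndep p (λ i → lincomb p (e i) v)
  lincomb-linIndep {v = v} {e} v-li e-li c ce·v≡0 = e-li c (v-li (lincomb p c e) λ a → begin
    ∑ p (λ j → ∑ p (λ i → c i * e i j) * v j a)     ≡⟨ ∑-cong (λ j → *-distribʳ-∑ (v j a) (λ i → c i * e i j)) ⟩
    ∑ p (λ j → ∑ p (λ i → c i * e i j * v j a))     ≡⟨ ∑-cong (λ j → ∑-cong (λ i → *-assoc (c i) (e i j) (v j a))) ⟩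
    ∑ p (λ j → ∑ p (λ i → c i * (e i j * v j a)))   ≡⟨ ∑-comm (λ i j → c i * (e i j * v j a)) ⟨
    ∑ p (λ i → ∑ p (λ j → c i * (e i j * v j a)))   ≡⟨ ∑-cong (λ i → *-distribˡ-∑ (c i) (λ j → e i j * v j a)) ⟨
    ∑ p (λ i → c i * lincomb p (e i) v a)           ≡⟨ ce·v≡0 a ⟩
    0#                                              ∎)

  linIndep-tail : ∀ {n k} (v : Fin (suc k) → Vec p n) → LinIndep p v → LinIndep p (λ i → v (Fin.suc i))
  linIndep-tail v v-li c c·v≡0 j =
    v-li (0# ∷ c) (λ a → trans (cong₂ _+_ (zeroˡ (v Fin.zero a)) (c·v≡0 a)) (+-identityˡ 0#)) (Fin.suc j)

  linIndep-subfamily : ∀ {n k m} → m ℕ.≤ k → (v : Fin k → Vec p n) → LinIndep p v →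
    ∃ λ (f : Fin m → Fin k) → LinIndep p (λ i → v (f i))
  linIndep-subfamily m≤k v v-li with ℕ.m≤n⇒m<n∨m≡n m≤k
  ... | inj₂ refl = (λ i → i) , v-li
  linIndep-subfamily {k = suc k} _ v v-li | inj₁ (ℕ.s≤s m≤k)
    with linIndep-subfamily m≤k (λ i → v (Fin.suc i)) (linIndep-tail v v-li)
  ... | f , v∘f-li = (λ i → Fin.suc (f i)) , v∘f-li

  linIndep-resp : ∀ {n k} → (LinIndep p {n} {k}) Respects Pointwise (Pointwise _≡_)
  linIndep-resp v≈w v-li c c·w≡0 = v-li c (λ a → trans (∑-cong (λ j → cong (c j *_) (v≈w j a))) (c·w≡0 a))

  totallyIsotropic-resp : ∀ {n k} {M N : Form p n} {v w : Fin k → Vec p n} → (∀ a b → M a b ≡ N a b) →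
    Pointwise (Pointwise _≡_) v w → TotallyIsotropic M v → TotallyIsotropic N w
  totallyIsotropic-resp M≗N v≈w M-iso i j = trans (sym (pair-cong M≗N (v≈w i) (v≈w j))) (M-iso i j)

  linIndep? : ∀ {n k} (v : Fin k → Vec p n) → Dec (LinIndep p v)
  linIndep? {k = k} v = all? (λ c≗c′ i → sym (c≗c′ i)) (Π-searchable refl (Fin-searchable p) k)
    (λ c≗c′ c-triv c′·v≡0 j →
      trans (sym (c≗c′ j)) (c-triv (λ a → trans (∑-cong (λ l → cong (_* v l a) (c≗c′ l))) (c′·v≡0 a)) j))
    (λ c → Fin.all? (λ a → lincomb p c v a Fin.≟ 0#) →-dec Fin.all? (λ j → c j Fin.≟ 0#))

  totallyIsotropic? : ∀ {n k} (C : Form p n) (v : Fin k → Vec p n) → Dec (TotallyIsotropic C v)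
  totallyIsotropic? C v = Fin.all? (λ i → Fin.all? (λ j → pair p C (v i) (v j) Fin.≟ 0#))

  HasIsotropicSubspace : ∀ {n} → Form p n → ℕ → Set
  HasIsotropicSubspace {n} C k = Σ (Fin k → Vec p n) λ v → LinIndep p v × TotallyIsotropic C v

  hasIsotropicSubspace? : ∀ {n} (C : Form p n) k → Dec (HasIsotropicSubspace C k)
  hasIsotropicSubspace? {n} C k = Π-searchable (λ _ → refl) (Π-searchable refl (Fin-searchable p) n) k
    (λ v≈w (v-li , v-iso) → linIndep-resp v≈w v-li , totallyIsotropic-resp {M = C} (λ _ _ → refl) v≈w v-iso)
    (λ v → linIndep? v ×-dec totallyIsotropic? C v)

  hasIsotropicSubspace-≤ : ∀ {n k m} {C : Form p n} → m ℕ.≤ k → HasIsotropicSubspace C k → HasIsotropicSubspace C m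
  hasIsotropicSubspace-≤ m≤k (v , v-li , v-iso) with linIndep-subfamily m≤k v v-li
  ... | f , v∘f-li = (λ i → v (f i)) , v∘f-li , (λ i j → v-iso (f i) (f j))

∸-triangle : ∀ n k m → n ℕ.∸ m ℕ.≤ n ℕ.∸ k ℕ.+ (k ℕ.∸ m)
∸-triangle n k m = ℕ.m≤n+o⇒m∸n≤o n m (begin
  n                                  ≤⟨ ℕ.m≤n+m∸n n k ⟩
  k ℕ.+ (n ℕ.∸ k)                    ≤⟨ ℕ.+-monoˡ-≤ (n ℕ.∸ k) (ℕ.m≤n+m∸n k m) ⟩
  m ℕ.+ (k ℕ.∸ m) ℕ.+ (n ℕ.∸ k)      ≡⟨ ℕ.+-assoc m _ _ ⟩
  m ℕ.+ ((k ℕ.∸ m) ℕ.+ (n ℕ.∸ k))    ≡⟨ cong (m ℕ.+_) (ℕ.+-comm (k ℕ.∸ m) _) ⟩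
  m ℕ.+ (n ℕ.∸ k ℕ.+ (k ℕ.∸ m))      ∎)
  where open ℕ.≤-Reasoning

module RankReduction (p : ℕ) .{{_ : NonZero p}} (p-prime : Prime p) (r : ℕ) where

  open PrimeField p using (commutativeRing; *F-inverse)
  open CommutativeRing commutativeRing using (_*_; 0#; 1#; *-comm)
  open Search
  open Forms p

  HasDegenerateCombination : ∀ {n d} → (Fin d → Form p n) → Set
  HasDegenerateCombination {n} M =
    ∃ λ a → ¬ (∀ j → a j ≡ 0#) × ∃ λ k → n ℕ.∸ k ℕ.≤ r × HasIsotropicSubspace (combF p a M) k

  hasDegenerateCombination? : ∀ {n d} (M : Fin d → Form p n) → Dec (HasDegenerateCombination M)
  hasDegenerateCombination? {n} {d} M =
    map′ (λ (a , a≢0 , k , _ , codim , V) → a , a≢0 , k , codim , V) bound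
      (Π-searchable refl (Fin-searchable p) d respects
        (λ a → ¬? (Fin.all? (λ j → a j Fin.≟ 0#)) ×-dec
               ℕ.anyUpTo? (λ k → n ℕ.∸ k ℕ.≤? r ×-dec hasIsotropicSubspace? (combF p a M) k) (suc n)))
    where
    Degenerate≤ : (Fin d → 𝔽 p) → Set
    Degenerate≤ a =
      ¬ (∀ j → a j ≡ 0#) × ∃ λ k → k ℕ.< suc n × (n ℕ.∸ k ℕ.≤ r × HasIsotropicSubspace (combF p a M) k)

    respects : Degenerate≤ Respects Pointwise _≡_
    respects a≗a′ (a≢0 , k , k≤n , codim , v , v-li , v-iso) =
      (λ a′≡0 → a≢0 (λ j → trans (a≗a′ j) (a′≡0 j))) , k , k≤n , codim , v , v-li ,
      totallyIsotropic-resp {v = v} (combF-cong M a≗a′) (λ _ _ → refl) v-iso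

    -- An isotropic family longer than n can be cut down to n vectors, since n ∸ n = 0 ≤ r.
    bound : HasDegenerateCombination M → ∃ Degenerate≤
    bound (a , a≢0 , k , codim , V) with k ℕ.≤? n
    ... | yes k≤n = a , a≢0 , k , ℕ.s≤s k≤n , codim , V
    ... | no k≰n  = a , a≢0 , n , ℕ.≤-refl , ℕ.≤-trans (ℕ.≤-reflexive (ℕ.n∸n≡0 n)) ℕ.z≤n ,
                    hasIsotropicSubspace-≤ {C = combF p a M} (ℕ.<⇒≤ (ℕ.≰⇒> k≰n)) V

  CombinationsRankGT : ∀ {m d} → (Fin d → Form p m) → Set
  CombinationsRankGT {d = d} M′ = ∀ (a : Fin d → 𝔽 p) → ¬ (∀ j → a j ≡ 0#) → RankGT p (combF p a M′) r

  Reduction : ∀ {n d} → (Fin d → Form p n) → Set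
  Reduction {n} {d} M = ∃ λ (m : ℕ) → Σ (Fin m → Vec p n) λ e →
    LinIndep p e × n ℕ.∸ m ℕ.≤ r ℕ.* d ×
    Σ ℕ λ d′ → d′ ℕ.≤ d × Σ (Fin d′ → Form p m) λ M′ →
      (∀ j → SelfAdjoint p (M′ j)) × CombinationsRankGT M′ × (∀ i → restrict p (M i) e ∈span M′)

  nondegenerate-reduction : ∀ {n d} (M : Fin d → Form p n) → (∀ i → SelfAdjoint p (M i)) →
    ¬ HasDegenerateCombination M → Reduction M
  nondegenerate-reduction {n} {d} M M-sa ¬deg =
    n , δ , δ-linIndep , ℕ.≤-trans (ℕ.≤-reflexive (ℕ.n∸n≡0 n)) ℕ.z≤n ,
    d , ℕ.≤-refl , M , M-sa , rank , λ i → ∈span-resp (restrict-δ (M i)) (∈span-member M i)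
    where
    rank : CombinationsRankGT M
    rank a a≢0 k (w , w-ker , w-li , _) =
      ℕ.≰⇒> λ codim≤r → ¬deg (a , a≢0 , k , codim≤r , w , w-li , λ i j → w-ker i (w j))

  degenerate-reduction : ∀ {n d} (M : Fin (suc d) → Form p n) → (∀ i → SelfAdjoint p (M i)) →
    HasDegenerateCombination M →
    (∀ {k} (N : Fin d → Form p k) → (∀ i → SelfAdjoint p (N i)) → Reduction N) → Reduction M
  degenerate-reduction {n} {d} M M-sa (a , a≢0 , k , codim-v , v , v-li , v-iso) reduce =
    extend (reduce N (λ i → restrict-selfAdjoint (M (Fin.punchIn j i)) v (M-sa (Fin.punchIn j i))))
    where
    nonzero : ∃ λ j → ¬ a j ≡ 0#
    nonzero = Fin.¬∀⟶∃¬ (suc d) (λ j → a j ≡ 0#) (λ j → a j Fin.≟ 0#) a≢0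

    j : Fin (suc d)
    j = proj₁ nonzero

    inverse : ∃ λ b → a j * b ≡ 1#
    inverse = *F-inverse p-prime (a j) (proj₂ nonzero)

    b*aj≡1 : proj₁ inverse * a j ≡ 1#
    b*aj≡1 = trans (*-comm (proj₁ inverse) (a j)) (proj₂ inverse)

    N : Fin d → Form p k
    N i = restrict p (M (Fin.punchIn j i)) v

    Mv∈span : ∀ i → restrict p (M i) v ∈span N
    Mv∈span i with i Fin.≟ j
    ... | yes refl = isotropic-combF⇒∈span M a v j (proj₁ inverse) b*aj≡1 v-iso
    ... | no i≢j = ∈span-resp (λ x y → cong (λ l → restrict p (M l) v x y) (sym (Fin.punchIn-punchOut j≢i)))
                              (∈span-member N (Fin.punchOut j≢i))
      where
      j≢i : j ≢ i
      j≢i j≡i = i≢j (sym j≡i)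

    extend : Reduction N → Reduction M
    extend (m , e , e-li , codim-e , d′ , d′≤d , M′ , M′-sa , M′-rank , N∈span) =
      m , (λ x → lincomb p (e x) v) , lincomb-linIndep v-li e-li , codim , d′ , ℕ.m≤n⇒m≤1+n d′≤d ,
      M′ , M′-sa , M′-rank ,
      λ i → ∈span-resp (λ x y → sym (restrict-pair (M i) v (e x) (e y)))
                       (∈span-trans (∈span-restrict e (Mv∈span i)) N∈span)
      where
      codim : n ℕ.∸ m ℕ.≤ r ℕ.* suc d
      codim = begin
        n ℕ.∸ m                        ≤⟨ ∸-triangle n k m ⟩
        n ℕ.∸ k ℕ.+ (k ℕ.∸ m)          ≤⟨ ℕ.+-mono-≤ codim-v codim-e ⟩
        r ℕ.+ r ℕ.* d                  ≡⟨ ℕ.*-suc r d ⟨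
        r ℕ.* suc d                    ∎
        where open ℕ.≤-Reasoning

  reduce : ∀ d {n} (M : Fin d → Form p n) → (∀ i → SelfAdjoint p (M i)) → Reduction M
  reduce d M M-sa with hasDegenerateCombination? M
  ... | no ¬deg = nondegenerate-reduction M M-sa ¬deg
  reduce zero    M M-sa | yes (a , a≢0 , _) = ⊥-elim (a≢0 (λ ()))
  reduce (suc d) M M-sa | yes deg = degenerate-reduction M M-sa deg (reduce d)

open import Data.Nat using (_≤_; _*_; _∸_)

lemma8p7 : (p : ℕ) .{{_ : NonZero p}} → Prime p → 5 ≤ p →
    (n d r : ℕ) → (M : Fin d → Form p n) → (∀ i → SelfAdjoint p (M i)) →
    ∃ λ (m : ℕ) → Σ (Fin m → Vec p n) λ e →
      LinIndep p e × n ∸ m ≤ r * d ×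
      Σ ℕ λ d' → d' ≤ d ×
        Σ (Fin d' → Form p m) λ M' →
          (∀ j → SelfAdjoint p (M' j)) ×
          (∀ (a : Fin d' → 𝔽 p) → ¬ (∀ j → a j ≡ 0F p) → RankGT p (combF p a M') r) ×
          (∀ i → ∃ λ (c : Fin d' → 𝔽 p) → ∀ x y → restrict p (M i) e x y ≡ combF p c M' x y)
lemma8p7 p p-prime _ n d r M M-sa = RankReduction.reduce p p-prime r d M M-sa
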